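{- For every $n\geq 1$, the number of binary shuffle squares of length $2n$ with exactly two occurrences of $\mathtt{1}$ equals $\frac{3n(n-1)}{2}+1$.
   Context: Binary words are over $\{\mathtt{0},\mathtt{1}\}$. A \emph{shuffle square} is a word whose positions can be partitioned into two sets so that the two resulting subwords (letters at those positions, in order) are identical. -}

module Defs where

open import Data.Bool using (Bool; true; false; not)
open import Data.Nat using (ℕ; zero; suc; _+_)
import Data.Nat as ℕ
open import Data.List using (List; []; _∷_; _++_; map; filter; length)
open import Data.List.Properties using (≡-dec)
open import Data.Vec using (Vec; []; _∷_)
open import Data.Bool.Properties using () renaming (_≟_ to _≟ᵇ_)
open import Data.Fin.Subset using (Subset; ∁)
open import Data.Fin.Subset.Properties using (anySubset?)
open import Data.Product using (∃; _×_)
open import Relation.Nullary using (Dec)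
open import Relation.Nullary.Decidable using (_×-dec_)
open import Relation.Binary.PropositionalEquality using (_≡_)

-- Binary words: letter 0 is 'false', letter 1 is 'true'.
Word : ℕ → Set
Word m = Vec Bool m

subword : ∀ {m} → Subset m → Word m → List Bool
subword []           []       = []
subword (true  ∷ S) (x ∷ w)  = x ∷ subword S w
subword (false ∷ S) (x ∷ w)  = subword S w

IsShuffleSquare : ∀ {m} → Word m → Set
IsShuffleSquare {m} w = ∃ λ (S : Subset m) → subword S w ≡ subword (∁ S) w

ones : ∀ {m} → Word m → ℕ
ones []           = 0
ones (true  ∷ w)  = suc (ones w)
ones (false ∷ w)  = ones w

allWords : (m : ℕ) → List (Word m)
allWords zero    = [] ∷ []
allWords (suc m) = map (false ∷_) (allWords m) ++ map (true ∷_) (allWords m)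

isShuffleSquare? : ∀ {m} (w : Word m) → Dec (IsShuffleSquare w)
isShuffleSquare? w = anySubset? (λ S → ≡-dec _≟ᵇ_ (subword S w) (subword (∁ S) w))

P : ∀ {m} → Word m → Set
P w = IsShuffleSquare w × ones w ≡ 2

P? : ∀ {m} (w : Word m) → Dec (P w)
P? w = isShuffleSquare? w ×-dec (ones w ℕ.≟ 2)

count : ℕ → ℕ
count m = length (filter P? (allWords m))

-- A word with exactly two 1s is 0^a 1 0^b 1 0^c, and it is a shuffle square iff it is an
-- interleaving of some u = 0^i 1 0^k with itself; each copy of u receives one of the 1s.
-- If the first 1 goes to one copy, the other copy has placed only j ≤ i of its zeros before
-- it, so the middle gap is made of its remaining i - j zeros and some of the first copy's
-- last k zeros: b ≤ i + k < |u|, and b = 0 forces j = i, i.e. a = 2i. Conversely, these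
-- conditions allow an explicit interleaving. For length 2n they read b < n and
-- (b = 0 → a even). Among the gap pairs (a, b), those with b < n number
-- Σ_{k<2n} min(k, n) = n(n-1)/2 + n², and n - 1 of them have b = 0 and a odd, which
-- leaves 3n(n-1)/2 + 1 shuffle squares.
module Submission where

open import Data.Bool using (Bool; true; false; not; _∧_; T)
open import Data.Bool.Properties using (T-∧)
open import Data.Fin.Subset using (Subset; ∁)
open import Data.List using (List; []; _∷_; _++_; length; map; filter; replicate)
open import Data.List.Properties
  using (filter-++; filter-≐; length-++; length-map; ++-assoc; length-replicate; ∷-injectiveʳ)
open import Data.List.Relation.Binary.Permutation.Propositional.Properties using (↭-length; filter-↭)
open import Data.List.Relation.Ternary.Interleaving.Propositional
  using (Interleaving; []; _∷ʳ_; consˡ; consʳ; swap; toPermutation)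
open import Data.List.Relation.Ternary.Interleaving.Properties using (interleave-length; ++⁺)
open import Data.Nat
  using (ℕ; zero; suc; _+_; _*_; _∸_; _/_; _≤_; _<_; _≥_; _⊓_; _<ᵇ_; _≡ᵇ_; z≤n; s≤s; s≤s⁻¹)
open import Data.Nat.Properties
open import Data.Nat.DivMod using (m*n/n≡m)
open import Data.Nat.Tactic.RingSolver using (solve-∀)
open import Algebra.Properties.CommutativeSemigroup +-commutativeSemigroup using (interchange)
open import Data.Product using (∃-syntax; _×_; _,_)
open import Data.Sum using (_⊎_; inj₁; inj₂)
open import Data.Empty using (⊥; ⊥-elim)
open import Data.Vec using ([]; _∷_; toList)
open import Data.Vec.Properties using (length-toList)
open import Function using (_∘_; _⇔_; mk⇔; Equivalence)
open import Function.Construct.Composition using (_⇔-∘_)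
open import Function.Construct.Symmetry using (⇔-sym)
open import Relation.Binary.PropositionalEquality
open import Relation.Nullary.Decidable using (T?; does)
open import Relation.Unary using (Decidable; _≐_)
open import Defs

data Even : ℕ → Set where
  even-zero : Even 0
  even-2+   : ∀ {n} → Even n → Even (suc (suc n))

Even-double : ∀ j → Even (j + j)
Even-double zero    = even-zero
Even-double (suc j) = subst (Even ∘ suc) (sym (+-suc j j)) (even-2+ (Even-double j))

Even⇒double : ∀ {n} → Even n → ∃[ j ] n ≡ j + j
Even⇒double even-zero   = 0 , refl
Even⇒double (even-2+ e) with Even⇒double e
... | j , refl = suc j , cong suc (sym (+-suc j j))

Even-2+⁻ : ∀ {n} → Even (suc (suc n)) → Even n
Even-2+⁻ (even-2+ e) = e

Even⇒¬Even-suc : ∀ {n} → Even n → Even (suc n) → ⊥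
Even⇒¬Even-suc (even-2+ e) (even-2+ e′) = Even⇒¬Even-suc e e′

Even-+ : ∀ m {n} → Even (m + n) → (Even m × Even n) ⊎ (Even (suc m) × Even (suc n))
Even-+ zero          e           = inj₁ (even-zero , e)
Even-+ (suc zero)    e           = inj₂ (even-2+ even-zero , e)
Even-+ (suc (suc m)) (even-2+ e) with Even-+ m e
... | inj₁ (em , en) = inj₁ (even-2+ em , en)
... | inj₂ (em , en) = inj₂ (even-2+ em , en)

even : ℕ → Bool
even zero          = true
even (suc zero)    = false
even (suc (suc n)) = even n

Even⇔even : ∀ {n} → Even n ⇔ T (even n)
Even⇔even = mk⇔ to (from _)
  where
    to : ∀ {n} → Even n → T (even n)
    to even-zero   = _
    to (even-2+ e) = to e
    from : ∀ n → T (even n) → Even n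
    from zero          _ = even-zero
    from (suc (suc n)) t = even-2+ (from n t)

zeros : ℕ → List Bool
zeros n = replicate n false

zeros-+ : ∀ m n → zeros (m + n) ≡ zeros m ++ zeros n
zeros-+ zero    n = refl
zeros-+ (suc m) n = cong (false ∷_) (zeros-+ m n)

zeros++true-injective : ∀ i j {x y} → zeros i ++ true ∷ x ≡ zeros j ++ true ∷ y → i ≡ j × x ≡ y
zeros++true-injective zero    zero    refl = refl , refl
zeros++true-injective (suc i) (suc j) eq
  with i≡j , x≡y ← zeros++true-injective i j (∷-injectiveʳ eq) = cong suc i≡j , x≡y

length-zeros++ : ∀ m x → length (zeros m ++ x) ≡ m + length x
length-zeros++ zero    x = refl
length-zeros++ (suc m) x = cong suc (length-zeros++ m x)

twoOnes : ℕ → ℕ → ℕ → List Bool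
twoOnes a b c = zeros a ++ true ∷ zeros b ++ true ∷ zeros c

length-twoOnes : ∀ a b c → length (twoOnes a b c) ≡ 2 + (a + b + c)
length-twoOnes a b c = begin
  length (twoOnes a b c)              ≡⟨ length-zeros++ a _ ⟩
  a + suc (length (zeros b ++ true ∷ zeros c)) ≡⟨ cong (λ n → a + suc n) (length-zeros++ b _) ⟩
  a + suc (b + suc (length (zeros c))) ≡⟨ cong (λ n → a + suc (b + suc n)) (length-replicate c) ⟩
  a + suc (b + suc c)                 ≡⟨ rearrange a b c ⟩
  2 + (a + b + c)                     ∎
  where
    open ≡-Reasoning
    rearrange : ∀ a b c → a + suc (b + suc c) ≡ 2 + (a + b + c)
    rearrange = solve-∀

countOnes : List Bool → ℕ
countOnes l = length (filter T? l)

countOnes-zeros : ∀ m → countOnes (zeros m) ≡ 0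
countOnes-zeros zero    = refl
countOnes-zeros (suc m) = countOnes-zeros m

countOnes-zeros++ : ∀ m x → countOnes (zeros m ++ x) ≡ countOnes x
countOnes-zeros++ zero    x = refl
countOnes-zeros++ (suc m) x = countOnes-zeros++ m x

countOnes-twoOnes : ∀ a b c → countOnes (twoOnes a b c) ≡ 2
countOnes-twoOnes a b c = begin
  countOnes (twoOnes a b c)                  ≡⟨ countOnes-zeros++ a _ ⟩
  suc (countOnes (zeros b ++ true ∷ zeros c)) ≡⟨ cong suc (countOnes-zeros++ b _) ⟩
  suc (suc (countOnes (zeros c)))             ≡⟨ cong (suc ∘ suc) (countOnes-zeros c) ⟩
  2                                           ∎
  where open ≡-Reasoning

countOnes≡0⇒zeros : ∀ l → countOnes l ≡ 0 → l ≡ zeros (length l)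
countOnes≡0⇒zeros []          _  = refl
countOnes≡0⇒zeros (false ∷ l) eq = cong (false ∷_) (countOnes≡0⇒zeros l eq)

countOnes≡suc⇒firstOne : ∀ l {k} → countOnes l ≡ suc k →
                         ∃[ a ] ∃[ l′ ] l ≡ zeros a ++ true ∷ l′ × countOnes l′ ≡ k
countOnes≡suc⇒firstOne (true ∷ l)  eq = 0 , l , refl , suc-injective eq
countOnes≡suc⇒firstOne (false ∷ l) eq
  with a , l′ , refl , eq′ ← countOnes≡suc⇒firstOne l eq = suc a , l′ , refl , eq′

countOnes≡2⇒twoOnes : ∀ l → countOnes l ≡ 2 → ∃[ a ] ∃[ b ] ∃[ c ] l ≡ twoOnes a b c
countOnes≡2⇒twoOnes l eq
  with a , l₁ , refl , eq₁ ← countOnes≡suc⇒firstOne l eq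
  with b , l₂ , refl , eq₂ ← countOnes≡suc⇒firstOne l₁ eq₁
  = a , b , length l₂ , cong (λ x → zeros a ++ true ∷ zeros b ++ true ∷ x) (countOnes≡0⇒zeros l₂ eq₂)

ones≡countOnes : ∀ {m} (w : Word m) → ones w ≡ countOnes (toList w)
ones≡countOnes []          = refl
ones≡countOnes (true ∷ w)  = cong suc (ones≡countOnes w)
ones≡countOnes (false ∷ w) = ones≡countOnes w

countOnes-interleaving : ∀ {l r as} → Interleaving l r as → countOnes as ≡ countOnes l + countOnes r
countOnes-interleaving {l} {r} {as} sp = begin
  countOnes as                          ≡⟨ ↭-length (filter-↭ T? (toPermutation sp)) ⟩
  length (filter T? (l ++ r))           ≡⟨ cong length (filter-++ T? l r) ⟩
  length (filter T? l ++ filter T? r)   ≡⟨ length-++ (filter T? l) ⟩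
  countOnes l + countOnes r             ∎
  where open ≡-Reasoning

SelfInterleaving : List Bool → Set
SelfInterleaving l = ∃[ u ] Interleaving u u l

subword-interleaving : ∀ {m} (S : Subset m) (w : Word m) →
                       Interleaving (subword S w) (subword (∁ S) w) (toList w)
subword-interleaving []          []      = []
subword-interleaving (true  ∷ S) (x ∷ w) = consˡ (subword-interleaving S w)
subword-interleaving (false ∷ S) (x ∷ w) = consʳ (subword-interleaving S w)

interleaving⇒subword : ∀ {m} (w : Word m) {u v} → Interleaving u v (toList w) →
                       ∃[ S ] subword S w ≡ u × subword (∁ S) w ≡ v
interleaving⇒subword []      []         = [] , refl , refl
interleaving⇒subword (x ∷ w) (consˡ sp)
  with S , refl , refl ← interleaving⇒subword w sp = true ∷ S , refl , refl
interleaving⇒subword (x ∷ w) (consʳ sp)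
  with S , refl , refl ← interleaving⇒subword w sp = false ∷ S , refl , refl

IsShuffleSquare⇔SelfInterleaving : ∀ {m} (w : Word m) →
                                   IsShuffleSquare w ⇔ SelfInterleaving (toList w)
IsShuffleSquare⇔SelfInterleaving w = mk⇔ to from
  where
    to : IsShuffleSquare w → SelfInterleaving (toList w)
    to (S , eq) =
      subword S w , subst (λ v → Interleaving (subword S w) v (toList w)) (sym eq) (subword-interleaving S w)
    from : SelfInterleaving (toList w) → IsShuffleSquare w
    from (u , sp) with S , eq , eq′ ← interleaving⇒subword w sp = S , trans eq (sym eq′)

data ZerosSplit (m : ℕ) (w : List Bool) : List Bool → List Bool → Set where
  zerosSplit : ∀ i j {x y} → i + j ≡ m → Interleaving x y w →
               ZerosSplit m w (zeros i ++ x) (zeros j ++ y)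

interleaving-zeros++ : ∀ m {w l r} → Interleaving l r (zeros m ++ w) → ZerosSplit m w l r
interleaving-zeros++ zero    sp         = zerosSplit 0 0 refl sp
interleaving-zeros++ (suc m) (consˡ sp) with zerosSplit i j eq sp′ ← interleaving-zeros++ m sp
  = zerosSplit (suc i) j (cong suc eq) sp′
interleaving-zeros++ (suc m) (consʳ sp) with zerosSplit i j eq sp′ ← interleaving-zeros++ m sp
  = zerosSplit i (suc j) (trans (+-suc i j) (cong suc eq)) sp′

zeros-++-zeros : ∀ m n x → zeros m ++ zeros n ++ x ≡ zeros (m + n) ++ x
zeros-++-zeros m n x = trans (sym (++-assoc (zeros m) (zeros n) x)) (cong (_++ x) (sym (zeros-+ m n)))

countOnes-interleaving-zeros : ∀ {c u v} → Interleaving u v (zeros c) → countOnes v ≡ 0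
countOnes-interleaving-zeros {c} {u} sp =
  m+n≡0⇒n≡0 (countOnes u) (trans (sym (countOnes-interleaving sp)) (countOnes-zeros c))

gapBounds-firstOneLeft : ∀ {b c i j u v} → Interleaving u v (zeros b ++ true ∷ zeros c) →
                         zeros i ++ true ∷ u ≡ zeros j ++ v →
                         b < length (zeros i ++ true ∷ u) × (b ≡ 0 → Even (i + j))
gapBounds-firstOneLeft {b} {i = i} {j} sp eq with interleaving-zeros++ b sp
-- both 1s went to u: then v, which equals u, gets no 1 at all
... | zerosSplit k l {y = v₃} refl (consˡ sp′) = ⊥-elim (0≢1+n (begin
  0                                               ≡⟨ sym (countOnes-interleaving-zeros sp′) ⟩
  countOnes v₃                                    ≡⟨ sym (countOnes-zeros++ (j + l) v₃) ⟩
  countOnes (zeros (j + l) ++ v₃)                 ≡⟨ cong countOnes (sym (zeros-++-zeros j l v₃)) ⟩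
  countOnes (zeros j ++ zeros l ++ v₃)            ≡⟨ cong countOnes (sym eq) ⟩
  countOnes (zeros i ++ true ∷ zeros k ++ true ∷ _) ≡⟨ countOnes-zeros++ i _ ⟩
  suc (countOnes (zeros k ++ true ∷ _))           ∎))
  where open ≡-Reasoning
... | zerosSplit k l refl (_∷ʳ_ {l = u₃} refl sp′)
  with refl , _ ← zeros++true-injective i (j + l) (trans eq (zeros-++-zeros j l _))
  = bound , even-if-adjacent
  where
    bound : k + l < length (zeros (j + l) ++ true ∷ zeros k ++ u₃)
    bound = begin
      suc (k + l)                               ≤⟨ m≤m+n (suc (k + l)) (j + length u₃) ⟩
      suc (k + l) + (j + length u₃)             ≡⟨ rearrange k l j (length u₃) ⟩
      j + l + suc (k + length u₃)               ≡⟨ cong (λ n → j + l + suc n) (length-zeros++ k u₃) ⟨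
      j + l + suc (length (zeros k ++ u₃))      ≡⟨ length-zeros++ (j + l) _ ⟨
      length (zeros (j + l) ++ true ∷ zeros k ++ u₃) ∎
      where
        open ≤-Reasoning
        rearrange : ∀ k l j n → suc (k + l) + (j + n) ≡ j + l + suc (k + n)
        rearrange = solve-∀
    even-if-adjacent : k + l ≡ 0 → Even (j + l + j)
    even-if-adjacent k+l≡0 with refl ← m+n≡0⇒n≡0 k k+l≡0 =
      subst Even (cong (_+ j) (sym (+-identityʳ j))) (Even-double j)

SelfInterleaving⇒gapBounds : ∀ {a b c u} → Interleaving u u (twoOnes a b c) →
                             b < length u × (b ≡ 0 → Even a)
SelfInterleaving⇒gapBounds sp = gapBounds sp refl
  where
    gapBounds : ∀ {a b c u v} → Interleaving u v (twoOnes a b c) → u ≡ v →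
                b < length u × (b ≡ 0 → Even a)
    gapBounds {a} {b} sp u≡v with interleaving-zeros++ a sp
    ... | zerosSplit i j refl (consˡ sp′) = gapBounds-firstOneLeft sp′ u≡v
    ... | zerosSplit i j refl (consʳ sp′)
      with b<v , even ← gapBounds-firstOneLeft (swap sp′) (sym u≡v)
      = subst (λ u → b < length u) (sym u≡v) b<v , subst Even (+-comm j i) ∘ even

-- Gaps of u = 0^(j+l) 1 0^(k+m) interleaved with itself: one copy takes l + j, k and m zeros
-- from the three blocks of zeros, the other j, l and k + m.
data SquareSplit : ℕ → ℕ → ℕ → Set where
  squareSplit : ∀ j l k m → SquareSplit (l + j + j) (l + k) (k + m + m)

squareSplit-suc-ab : ∀ {a b c} → SquareSplit a b c → SquareSplit (suc a) (suc b) c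
squareSplit-suc-ab (squareSplit j l k m) = squareSplit j (suc l) k m

squareSplit-suc-bc : ∀ {a b c} → SquareSplit a b c → SquareSplit a (suc b) (suc c)
squareSplit-suc-bc (squareSplit j l k m) =
  subst (λ b → SquareSplit (l + j + j) b (suc (k + m + m))) (+-suc l k) (squareSplit j l (suc k) m)

gapBounds⇒SquareSplit : ∀ a b c → b ≤ a + c → Even (a + b + c) → (b ≡ 0 → Even a) → SquareSplit a b c
gapBounds⇒SquareSplit a zero c _ e even-a
  with Even-+ a (subst Even (cong (_+ c) (+-identityʳ a)) e)
... | inj₂ (e-suc-a , _) = ⊥-elim (Even⇒¬Even-suc (even-a refl) e-suc-a)
... | inj₁ (ea , ec)
  with j , refl ← Even⇒double ea
  with m , refl ← Even⇒double ec
  = squareSplit j 0 0 m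
gapBounds⇒SquareSplit a (suc zero) c _ e _
  with Even-+ a (subst Even (+-assoc a 1 c) e)
... | inj₁ (ea , even-2+ ec)
  with j , refl ← Even⇒double ea
  with m , refl ← Even⇒double ec
  = squareSplit-suc-bc (squareSplit j 0 0 m)
... | inj₂ (even-2+ ea , even-2+ ec)
  with j , refl ← Even⇒double ea
  with m , refl ← Even⇒double ec
  = squareSplit-suc-ab (squareSplit j 0 0 m)
gapBounds⇒SquareSplit (suc a) (suc (suc b)) c (s≤s le) e _ =
  squareSplit-suc-ab (gapBounds⇒SquareSplit a (suc b) c le
    (Even-2+⁻ (subst (λ n → Even (suc (n + c))) (+-suc a (suc b)) e)) (λ ()))
gapBounds⇒SquareSplit zero (suc (suc b)) (suc c) (s≤s le) e _ =
  squareSplit-suc-bc (gapBounds⇒SquareSplit zero (suc b) c le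
    (subst Even (+-suc b c) (Even-2+⁻ e)) (λ ()))

zeros-interleaving : ∀ m n → Interleaving (zeros m) (zeros n) (zeros (m + n))
zeros-interleaving zero    zero    = []
zeros-interleaving zero    (suc n) = consʳ (zeros-interleaving zero n)
zeros-interleaving (suc m) n       = consˡ (zeros-interleaving m n)

SquareSplit⇒SelfInterleaving : ∀ {a b c} → SquareSplit a b c → SelfInterleaving (twoOnes a b c)
SquareSplit⇒SelfInterleaving (squareSplit j l k m) =
  zeros (j + l) ++ true ∷ zeros (k + m) , subst₂ (λ x y → Interleaving x y w) left right sp
  where
    w : List Bool
    w = twoOnes (l + j + j) (l + k) (k + m + m)
    sp : Interleaving (zeros (l + j) ++ true ∷ zeros k ++ zeros m)
                      (zeros j ++ zeros l ++ true ∷ zeros (k + m))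
                      w
    sp = ++⁺ (zeros-interleaving (l + j) j)
             (consˡ (++⁺ (swap (zeros-interleaving l k))
                         (consʳ (swap (zeros-interleaving (k + m) m)))))
    left : zeros (l + j) ++ true ∷ zeros k ++ zeros m ≡ zeros (j + l) ++ true ∷ zeros (k + m)
    left = cong₂ (λ p q → zeros p ++ true ∷ q) (+-comm l j) (sym (zeros-+ k m))
    right : zeros j ++ zeros l ++ true ∷ zeros (k + m) ≡ zeros (j + l) ++ true ∷ zeros (k + m)
    right = zeros-++-zeros j l (true ∷ zeros (k + m))

double-injective : ∀ {m n} → m + m ≡ n + n → m ≡ n
double-injective {zero}  {zero}  _  = refl
double-injective {suc m} {suc n} eq =
  cong suc (double-injective (suc-injective (begin
    suc (m + m)   ≡⟨ +-suc m m ⟨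
    m + suc m     ≡⟨ suc-injective eq ⟩
    n + suc n     ≡⟨ +-suc n n ⟩
    suc (n + n)   ∎)))
  where open ≡-Reasoning

SelfInterleaving⇔gapBounds : ∀ {a b c} B → a + b + c ≡ B + B →
  SelfInterleaving (twoOnes a b c) ⇔ (b ≤ B × (b ≡ 0 → Even a))
SelfInterleaving⇔gapBounds {a} {b} {c} B a+b+c≡B+B = mk⇔ to from
  where
    to : SelfInterleaving (twoOnes a b c) → b ≤ B × (b ≡ 0 → Even a)
    to (u , sp) with b<u , even ← SelfInterleaving⇒gapBounds sp = s≤s⁻¹ (subst (b <_) ∣u∣≡1+B b<u) , even
      where
        ∣u∣≡1+B : length u ≡ suc B
        ∣u∣≡1+B = double-injective (begin
          length u + length u       ≡⟨ interleave-length sp ⟨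
          length (twoOnes a b c)    ≡⟨ length-twoOnes a b c ⟩
          2 + (a + b + c)           ≡⟨ cong (2 +_) a+b+c≡B+B ⟩
          2 + (B + B)               ≡⟨ cong suc (+-suc B B) ⟨
          suc B + suc B             ∎)
          where open ≡-Reasoning
    from : b ≤ B × (b ≡ 0 → Even a) → SelfInterleaving (twoOnes a b c)
    from (b≤B , even) = SquareSplit⇒SelfInterleaving (gapBounds⇒SquareSplit a b c b≤a+c even-abc even)
      where
        even-abc : Even (a + b + c)
        even-abc = subst Even (sym a+b+c≡B+B) (Even-double B)
        b≤a+c : b ≤ a + c
        b≤a+c = +-cancelˡ-≤ b b (a + c) (begin
          b + b         ≤⟨ +-mono-≤ b≤B b≤B ⟩
          B + B         ≡⟨ a+b+c≡B+B ⟨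
          a + b + c     ≡⟨ cong (_+ c) (+-comm a b) ⟩
          b + a + c     ≡⟨ +-assoc b a c ⟩
          b + (a + c)   ∎)
          where open ≤-Reasoning

allZeros : List Bool → Bool
allZeros []          = true
allZeros (false ∷ l) = allZeros l
allZeros (true ∷ l)  = false

oneOneWith : (ℕ → Bool) → List Bool → Bool
oneOneWith R []          = false
oneOneWith R (false ∷ l) = oneOneWith (R ∘ suc) l
oneOneWith R (true ∷ l)  = R 0 ∧ allZeros l

twoOnesWith : (ℕ → ℕ → Bool) → List Bool → Bool
twoOnesWith R []          = false
twoOnesWith R (false ∷ l) = twoOnesWith (R ∘ suc) l
twoOnesWith R (true ∷ l)  = oneOneWith (R 0) l

allZeros⇒zeros : ∀ l → T (allZeros l) → l ≡ zeros (length l)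
allZeros⇒zeros []          _ = refl
allZeros⇒zeros (false ∷ l) t = cong (false ∷_) (allZeros⇒zeros l t)

allZeros-zeros : ∀ c → T (allZeros (zeros c))
allZeros-zeros zero    = _
allZeros-zeros (suc c) = allZeros-zeros c

oneOneWith-sound : ∀ R l → T (oneOneWith R l) →
                   ∃[ b ] ∃[ c ] l ≡ zeros b ++ true ∷ zeros c × T (R b)
oneOneWith-sound R (false ∷ l) t
  with b , c , refl , r ← oneOneWith-sound (R ∘ suc) l t = suc b , c , refl , r
oneOneWith-sound R (true ∷ l)  t
  with r , z ← Equivalence.to T-∧ t = 0 , length l , cong (true ∷_) (allZeros⇒zeros l z) , r

oneOneWith-complete : ∀ R b c → T (R b) → T (oneOneWith R (zeros b ++ true ∷ zeros c))
oneOneWith-complete R zero    c r = Equivalence.from T-∧ (r , allZeros-zeros c)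
oneOneWith-complete R (suc b) c r = oneOneWith-complete (R ∘ suc) b c r

twoOnesWith-sound : ∀ R l → T (twoOnesWith R l) →
                    ∃[ a ] ∃[ b ] ∃[ c ] l ≡ twoOnes a b c × T (R a b)
twoOnesWith-sound R (false ∷ l) t
  with a , b , c , refl , r ← twoOnesWith-sound (R ∘ suc) l t = suc a , b , c , refl , r
twoOnesWith-sound R (true ∷ l)  t
  with b , c , refl , r ← oneOneWith-sound (R 0) l t = 0 , b , c , refl , r

twoOnesWith-complete : ∀ R a b c → T (R a b) → T (twoOnesWith R (twoOnes a b c))
twoOnesWith-complete R zero    b c r = oneOneWith-complete (R 0) b c r
twoOnesWith-complete R (suc a) b c r = twoOnesWith-complete (R ∘ suc) a b c r

⟦_⟧ : Bool → ℕ
⟦ true  ⟧ = 1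
⟦ false ⟧ = 0

countBelow : ℕ → (ℕ → Bool) → ℕ
countBelow zero    R = 0
countBelow (suc k) R = countBelow k (R ∘ suc) + ⟦ R 0 ⟧

-- countPairsBelow k R = #{(a, b) | a + b + 2 ≤ k, R a b}: the two leading gaps of the
-- words of length k with two 1s.
countPairsBelow : ℕ → (ℕ → ℕ → Bool) → ℕ
countPairsBelow zero    R = 0
countPairsBelow (suc k) R = countPairsBelow k (R ∘ suc) + countBelow k (R 0)

countBelow-false : ∀ k → countBelow k (λ _ → false) ≡ 0
countBelow-false zero    = refl
countBelow-false (suc k) = trans (+-identityʳ _) (countBelow-false k)

countBelow-atZero : ∀ k x → countBelow (suc k) (λ b → (b ≡ᵇ 0) ∧ x) ≡ ⟦ x ⟧
countBelow-atZero k x = cong (_+ ⟦ x ⟧) (countBelow-false k)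

countBelow-+ : ∀ k {R S U} → (∀ b → ⟦ R b ⟧ + ⟦ S b ⟧ ≡ ⟦ U b ⟧) →
               countBelow k R + countBelow k S ≡ countBelow k U
countBelow-+ zero    _   = refl
countBelow-+ (suc k) {R} {S} R+S≡U = trans
  (interchange (countBelow k (R ∘ suc)) ⟦ R 0 ⟧ (countBelow k (S ∘ suc)) ⟦ S 0 ⟧)
  (cong₂ _+_ (countBelow-+ k (R+S≡U ∘ suc)) (R+S≡U 0))

countPairsBelow-+ : ∀ k {R S U} → (∀ a b → ⟦ R a b ⟧ + ⟦ S a b ⟧ ≡ ⟦ U a b ⟧) →
                    countPairsBelow k R + countPairsBelow k S ≡ countPairsBelow k U
countPairsBelow-+ zero    _   = refl
countPairsBelow-+ (suc k) {R} {S} R+S≡U = trans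
  (interchange (countPairsBelow k (R ∘ suc)) (countBelow k (R 0))
               (countPairsBelow k (S ∘ suc)) (countBelow k (S 0)))
  (cong₂ _+_ (countPairsBelow-+ k (R+S≡U ∘ suc)) (countBelow-+ k (R+S≡U 0)))

countBelow-<ᵇ : ∀ k n → countBelow k (_<ᵇ n) ≡ k ⊓ n
countBelow-<ᵇ zero    n       = refl
countBelow-<ᵇ (suc k) zero    = trans (+-identityʳ _) (countBelow-false k)
countBelow-<ᵇ (suc k) (suc n) = trans (+-comm _ 1) (cong suc (countBelow-<ᵇ k n))

filter-map : ∀ {a b p} {A : Set a} {B : Set b} {P : B → Set p} (P? : Decidable P) (g : A → B) xs →
             filter P? (map g xs) ≡ map g (filter (P? ∘ g) xs)
filter-map P? g []       = refl
filter-map P? g (x ∷ xs) with does (P? (g x))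
... | true  = cong (g x ∷_) (filter-map P? g xs)
... | false = filter-map P? g xs

#words : ℕ → (List Bool → Bool) → ℕ
#words k f = length (filter (λ w → T? (f (toList w))) (allWords k))

#words-suc : ∀ k f → #words (suc k) f ≡ #words k (f ∘ (false ∷_)) + #words k (f ∘ (true ∷_))
#words-suc k f = begin
  length (filter Q? (map (false ∷_) ws ++ map (true ∷_) ws))
    ≡⟨ cong length (filter-++ Q? (map (false ∷_) ws) _) ⟩
  length (filter Q? (map (false ∷_) ws) ++ filter Q? (map (true ∷_) ws))
    ≡⟨ length-++ (filter Q? (map (false ∷_) ws)) ⟩
  length (filter Q? (map (false ∷_) ws)) + length (filter Q? (map (true ∷_) ws))
    ≡⟨ cong₂ _+_ (length-filter-map (false ∷_)) (length-filter-map (true ∷_)) ⟩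
  #words k (f ∘ (false ∷_)) + #words k (f ∘ (true ∷_)) ∎
  where
    open ≡-Reasoning
    ws : List (Word k)
    ws = allWords k
    Q? : Decidable (λ (w : Word (suc k)) → T (f (toList w)))
    Q? w = T? (f (toList w))
    length-filter-map : ∀ g → length (filter Q? (map g ws)) ≡ length (filter (Q? ∘ g) ws)
    length-filter-map g = trans (cong length (filter-map Q? g ws)) (length-map g (filter (Q? ∘ g) ws))

#words-false : ∀ k → #words k (λ _ → false) ≡ 0
#words-false zero    = refl
#words-false (suc k) = trans (#words-suc k _) (cong₂ _+_ (#words-false k) (#words-false k))

#words-allZeros : ∀ k → #words k allZeros ≡ 1
#words-allZeros zero    = refl
#words-allZeros (suc k) = trans (#words-suc k allZeros) (cong₂ _+_ (#words-allZeros k) (#words-false k))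

#words-oneOneWith : ∀ k R → #words k (oneOneWith R) ≡ countBelow k R
#words-oneOneWith zero    R = refl
#words-oneOneWith (suc k) R =
  trans (#words-suc k (oneOneWith R))
        (cong₂ _+_ (#words-oneOneWith k (R ∘ suc)) (zerosAfterOne (R 0)))
  where
    zerosAfterOne : ∀ x → #words k (λ l → x ∧ allZeros l) ≡ ⟦ x ⟧
    zerosAfterOne true  = #words-allZeros k
    zerosAfterOne false = #words-false k

#words-twoOnesWith : ∀ k R → #words k (twoOnesWith R) ≡ countPairsBelow k R
#words-twoOnesWith zero    R = refl
#words-twoOnesWith (suc k) R =
  trans (#words-suc k (twoOnesWith R))
        (cong₂ _+_ (#words-twoOnesWith k (R ∘ suc)) (#words-oneOneWith k (R 0)))

squareGaps? : ℕ → ℕ → ℕ → Bool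
squareGaps? B a zero    = even a
squareGaps? B a (suc b) = b <ᵇ B

T-squareGaps? : ∀ B a b → T (squareGaps? B a b) ⇔ (b ≤ B × (b ≡ 0 → Even a))
T-squareGaps? B a zero    = mk⇔ (λ t → z≤n , λ _ → Equivalence.from Even⇔even t)
                                (λ (_ , even) → Equivalence.to Even⇔even (even refl))
T-squareGaps? B a (suc b) = mk⇔ (λ t → <ᵇ⇒< b B t , λ ()) (λ (b<B , _) → <⇒<ᵇ b<B)

middleGap<? : ℕ → ℕ → ℕ → Bool
middleGap<? n _ b = b <ᵇ n

oddBeforeAdjacent? : ℕ → ℕ → Bool
oddBeforeAdjacent? a b = (b ≡ᵇ 0) ∧ not (even a)

squareGaps?+oddBeforeAdjacent? : ∀ B a b →
  ⟦ squareGaps? B a b ⟧ + ⟦ oddBeforeAdjacent? a b ⟧ ≡ ⟦ middleGap<? (suc B) a b ⟧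
squareGaps?+oddBeforeAdjacent? B a zero with even a
... | true  = refl
... | false = refl
squareGaps?+oddBeforeAdjacent? B a (suc b) = +-identityʳ _

countPairsBelow-oddBeforeAdjacent? : ∀ t → countPairsBelow (2 + (t + t)) oddBeforeAdjacent? ≡ t
countPairsBelow-oddBeforeAdjacent? zero    = refl
countPairsBelow-oddBeforeAdjacent? (suc t) = begin
  countPairsBelow (2 + (suc t + suc t)) oddBeforeAdjacent?
    ≡⟨ cong (λ k → countPairsBelow (3 + k) oddBeforeAdjacent?) (+-suc t t) ⟩
  countPairsBelow (2 + (t + t)) oddBeforeAdjacent? + countBelow (2 + (t + t)) (oddBeforeAdjacent? 1)
    + countBelow (3 + (t + t)) (oddBeforeAdjacent? 0)
    ≡⟨ cong₂ _+_ (cong₂ _+_ (countPairsBelow-oddBeforeAdjacent? t) (countBelow-atZero (1 + (t + t)) true))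
                 (countBelow-atZero (2 + (t + t)) false) ⟩
  t + 1 + 0
    ≡⟨ trans (+-identityʳ (t + 1)) (+-comm t 1) ⟩
  suc t ∎
  where open ≡-Reasoning

countPairsBelow-middleGap<?-suc : ∀ n k →
  countPairsBelow (suc k) (middleGap<? n) ≡ countPairsBelow k (middleGap<? n) + k ⊓ n
countPairsBelow-middleGap<?-suc n k = cong (countPairsBelow k (middleGap<? n) +_) (countBelow-<ᵇ k n)

countPairsBelow-middleGap<?-≤ : ∀ n k → k ≤ n →
  countPairsBelow k (middleGap<? n) + countPairsBelow k (middleGap<? n) + k ≡ k * k
countPairsBelow-middleGap<?-≤ n zero    _   = refl
countPairsBelow-middleGap<?-≤ n (suc k) k<n = begin
  S (suc k) + S (suc k) + suc k       ≡⟨ cong (λ x → x + x + suc k) S-suc ⟩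
  (S k + k) + (S k + k) + suc k       ≡⟨ rearrange (S k) k ⟩
  (S k + S k + k) + (k + suc k)       ≡⟨ cong (_+ (k + suc k)) (countPairsBelow-middleGap<?-≤ n k (<⇒≤ k<n)) ⟩
  k * k + (k + suc k)                 ≡⟨ square-suc k ⟩
  suc k * suc k                       ∎
  where
    open ≡-Reasoning
    S : ℕ → ℕ
    S k = countPairsBelow k (middleGap<? n)
    S-suc : S (suc k) ≡ S k + k
    S-suc = trans (countPairsBelow-middleGap<?-suc n k) (cong (S k +_) (m≤n⇒m⊓n≡m (<⇒≤ k<n)))
    rearrange : ∀ p k → (p + k) + (p + k) + suc k ≡ (p + p + k) + (k + suc k)
    rearrange = solve-∀
    square-suc : ∀ k → k * k + (k + suc k) ≡ suc k * suc k
    square-suc = solve-∀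

countPairsBelow-middleGap<?-≥ : ∀ n i →
  countPairsBelow (n + i) (middleGap<? n) ≡ countPairsBelow n (middleGap<? n) + i * n
countPairsBelow-middleGap<?-≥ n zero    =
  trans (cong (λ k → countPairsBelow k (middleGap<? n)) (+-identityʳ n)) (sym (+-identityʳ _))
countPairsBelow-middleGap<?-≥ n (suc i) = begin
  S (n + suc i)             ≡⟨ cong S (+-suc n i) ⟩
  S (suc (n + i))           ≡⟨ countPairsBelow-middleGap<?-suc n (n + i) ⟩
  S (n + i) + (n + i) ⊓ n   ≡⟨ cong₂ _+_ (countPairsBelow-middleGap<?-≥ n i) (m≥n⇒m⊓n≡n (m≤m+n n i)) ⟩
  S n + i * n + n           ≡⟨ +-assoc (S n) (i * n) n ⟩
  S n + (i * n + n)         ≡⟨ cong (S n +_) (+-comm (i * n) n) ⟩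
  S n + suc i * n           ∎
  where
    open ≡-Reasoning
    S : ℕ → ℕ
    S k = countPairsBelow k (middleGap<? n)

countPairsBelow-middleGap<?-double : ∀ n → countPairsBelow (2 * n) (middleGap<? n) ≡
  countPairsBelow n (middleGap<? n) + n * n
countPairsBelow-middleGap<?-double n =
  trans (cong (λ k → countPairsBelow k (middleGap<? n)) (twice n)) (countPairsBelow-middleGap<?-≥ n n)
  where
    twice : ∀ n → 2 * n ≡ n + n
    twice = solve-∀

countPairsBelow-squareGaps?+ : ∀ B →
  countPairsBelow (2 * suc B) (squareGaps? B) + B ≡ countPairsBelow (2 * suc B) (middleGap<? (suc B))
countPairsBelow-squareGaps?+ B = begin
  G + B
    ≡⟨ cong (G +_) (countPairsBelow-oddBeforeAdjacent? B) ⟨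
  G + countPairsBelow (2 + (B + B)) oddBeforeAdjacent?
    ≡⟨ cong (λ k → G + countPairsBelow k oddBeforeAdjacent?) (double B) ⟩
  G + countPairsBelow (2 * suc B) oddBeforeAdjacent?
    ≡⟨ countPairsBelow-+ (2 * suc B) {squareGaps? B} (squareGaps?+oddBeforeAdjacent? B) ⟩
  countPairsBelow (2 * suc B) (middleGap<? (suc B)) ∎
  where
    open ≡-Reasoning
    G : ℕ
    G = countPairsBelow (2 * suc B) (squareGaps? B)
    double : ∀ B → 2 + (B + B) ≡ 2 * suc B
    double = solve-∀

countPairsBelow-squareGaps? : ∀ B → countPairsBelow (2 * suc B) (squareGaps? B) ≡ 3 * suc B * B / 2 + 1
countPairsBelow-squareGaps? B = begin
  G                   ≡⟨ +-cancelʳ-≡ B G (h + 1) G+B≡h+1+B ⟩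
  h + 1               ≡⟨ cong (_+ 1) (m*n/n≡m h 2) ⟨
  h * 2 / 2 + 1       ≡⟨ cong (λ x → x / 2 + 1) h*2≡3nB ⟩
  3 * n * B / 2 + 1   ∎
  where
    open ≡-Reasoning
    n : ℕ
    n = suc B
    S : ℕ
    S = countPairsBelow n (middleGap<? n)
    G : ℕ
    G = countPairsBelow (2 * n) (squareGaps? B)
    h : ℕ
    h = S + n * B
    G+B≡h+1+B : G + B ≡ h + 1 + B
    G+B≡h+1+B = trans (countPairsBelow-squareGaps?+ B)
      (trans (countPairsBelow-middleGap<?-double n) (expand S B))
      where
        expand : ∀ s B → s + suc B * suc B ≡ s + suc B * B + 1 + B
        expand = solve-∀
    S+S≡nB : S + S ≡ n * B
    S+S≡nB = +-cancelʳ-≡ n (S + S) (n * B) (trans (countPairsBelow-middleGap<?-≤ n n ≤-refl) (square B))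
      where
        square : ∀ B → suc B * suc B ≡ suc B * B + suc B
        square = solve-∀
    h*2≡3nB : h * 2 ≡ 3 * n * B
    h*2≡3nB = begin
      (S + n * B) * 2         ≡⟨ distribute S (n * B) ⟩
      (S + S) + n * B * 2     ≡⟨ cong (_+ n * B * 2) S+S≡nB ⟩
      n * B + n * B * 2       ≡⟨ triple n B ⟩
      3 * n * B               ∎
      where
        distribute : ∀ s m → (s + m) * 2 ≡ (s + s) + m * 2
        distribute = solve-∀
        triple : ∀ n B → n * B + n * B * 2 ≡ 3 * n * B
        triple = solve-∀

P⇔twoOnesWith-squareGaps? : ∀ B (w : Word (2 * suc B)) → P w ⇔ T (twoOnesWith (squareGaps? B) (toList w))
P⇔twoOnesWith-squareGaps? B w = mk⇔ to from
  where
    open ≡-Reasoning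
    gapSum : ∀ {a b c} → toList w ≡ twoOnes a b c → a + b + c ≡ B + B
    gapSum {a} {b} {c} eq = +-cancelˡ-≡ 2 (a + b + c) (B + B) (begin
      2 + (a + b + c)         ≡⟨ length-twoOnes a b c ⟨
      length (twoOnes a b c)  ≡⟨ cong length eq ⟨
      length (toList w)       ≡⟨ length-toList w ⟩
      2 * suc B               ≡⟨ double B ⟩
      2 + (B + B)             ∎)
      where
        double : ∀ B → 2 * suc B ≡ 2 + (B + B)
        double = solve-∀
    square⇔ : ∀ {a b c} → toList w ≡ twoOnes a b c → IsShuffleSquare w ⇔ T (squareGaps? B a b)
    square⇔ {a} {b} eq =
      ⇔-sym (T-squareGaps? B a b) ⇔-∘ (SelfInterleaving⇔gapBounds B (gapSum eq) ⇔-∘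
        subst (λ l → IsShuffleSquare w ⇔ SelfInterleaving l) eq (IsShuffleSquare⇔SelfInterleaving w))
    to : P w → T (twoOnesWith (squareGaps? B) (toList w))
    to (square , ones≡2)
      with a , b , c , eq ← countOnes≡2⇒twoOnes (toList w) (trans (sym (ones≡countOnes w)) ones≡2)
      = subst (T ∘ twoOnesWith (squareGaps? B)) (sym eq)
          (twoOnesWith-complete (squareGaps? B) a b c (Equivalence.to (square⇔ eq) square))
    from : T (twoOnesWith (squareGaps? B) (toList w)) → P w
    from t with a , b , c , eq , r ← twoOnesWith-sound (squareGaps? B) (toList w) t
      = Equivalence.from (square⇔ eq) r
      , trans (ones≡countOnes w) (trans (cong countOnes eq) (countOnes-twoOnes a b c))

corollary10 : (n : ℕ) → n ≥ 1 → count (2 * n) ≡ (3 * n * (n ∸ 1)) / 2 + 1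
corollary10 (suc B) _ = begin
  count (2 * suc B)
    ≡⟨ cong length (filter-≐ P? _ ≐-twoOnesWith (allWords _)) ⟩
  #words (2 * suc B) (twoOnesWith (squareGaps? B))
    ≡⟨ #words-twoOnesWith (2 * suc B) (squareGaps? B) ⟩
  countPairsBelow (2 * suc B) (squareGaps? B)
    ≡⟨ countPairsBelow-squareGaps? B ⟩
  3 * suc B * B / 2 + 1 ∎
  where
    open ≡-Reasoning
    ≐-twoOnesWith : P ≐ (T ∘ twoOnesWith (squareGaps? B) ∘ toList)
    ≐-twoOnesWith = (λ {w} → Equivalence.to (P⇔twoOnesWith-squareGaps? B w))
                  , (λ {w} → Equivalence.from (P⇔twoOnesWith-squareGaps? B w))
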